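{- Let $r\ge 2$ be an integer and let $G=(V_1\cup V_2,E)$ be a balanced bipartite graph (with parts $V_1,V_2$ of equal size) of order $cn$, where $c>2^r-1$. Assume that for every two sets $S\subseteq V_1$ and $T\subseteq V_2$ with $|S|=|T|=\left((c+1)/2^r-1\right)n/2$ there is at least one edge between $S$ and $T$. Then $G\to(P_n)_r$.
   Context: $P_n$ is the path on $n$ vertices. $G\to(P_n)_r$ means every colouring of the edges of $G$ with $r$ colours yields a monochromatic copy of $P_n$. -}

module Defs where

open import Data.Nat using (ℕ; suc; _+_; _*_; _^_; _≤_; _<_)
open import Data.Bool using (Bool; true)
open import Data.Fin using (Fin; toℕ)
open import Data.Fin.Subset using (Subset; _∈_; ∣_∣)
open import Data.Sum using (_⊎_; inj₁; inj₂)
open import Data.Product using (_×_; ∃; Σ-syntax; ∃-syntax)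
open import Data.Empty using (⊥)
open import Function.Definitions using (Injective)
open import Relation.Binary.PropositionalEquality using (_≡_)

-- A balanced bipartite graph with parts V₁ = Fin m and V₂ = Fin m is given
-- by its bipartite adjacency: E a b ≡ true iff a ∈ V₁ is joined to b ∈ V₂.
BipGraph : ℕ → Set
BipGraph m = Fin m → Fin m → Bool

Vertex : ℕ → Set
Vertex m = Fin m ⊎ Fin m

-- An r-colouring of the edges (colour values on non-edges are irrelevant).
EdgeColouring : ℕ → ℕ → Set
EdgeColouring m r = Fin m → Fin m → Fin r

EdgeOfColour : ∀ {m r} → BipGraph m → EdgeColouring m r → Fin r →
               Vertex m → Vertex m → Set
EdgeOfColour E χ k (inj₁ a) (inj₂ b) = (E a b ≡ true) × (χ a b ≡ k)
EdgeOfColour E χ k (inj₂ b) (inj₁ a) = (E a b ≡ true) × (χ a b ≡ k)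
EdgeOfColour E χ k (inj₁ _) (inj₁ _) = ⊥
EdgeOfColour E χ k (inj₂ _) (inj₂ _) = ⊥

MonoPath : ∀ {m r} → BipGraph m → EdgeColouring m r → Fin r → ℕ → Set
MonoPath {m} E χ k n =
  Σ[ p ∈ (Fin n → Vertex m) ]
    (Injective _≡_ _≡_ p ×
     (∀ (i j : Fin n) → suc (toℕ i) ≡ toℕ j → EdgeOfColour E χ k (p i) (p j)))

Arrows : ∀ {m} → BipGraph m → ℕ → ℕ → Set
Arrows {m} E n r = ∀ (χ : EdgeColouring m r) → ∃[ k ] MonoPath E χ k n

EdgeBetween : ∀ {m} → BipGraph m → Subset m → Subset m → Set
EdgeBetween E S T = ∃[ a ] ∃[ b ] (a ∈ S × b ∈ T × E a b ≡ true)

-- With order N = 2m = c·n, the threshold ((c+1)/2^r - 1)·n/2 equals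
-- (N + n - 2^r n) / 2^(r+1).  "s ≥ threshold" cleared of denominators:
AtLeastThreshold : ℕ → ℕ → ℕ → ℕ → Set
AtLeastThreshold r m n s = m + m + n ≤ 2 ^ (suc r) * s + 2 ^ r * n

module Submission where

-- Fix a colour and run a depth-first search on the edges of that colour between X ⊆ V₁ and
-- Y ⊆ V₂, keeping the vertices unvisited (S), on the stack (U) or finished (T). The stack is
-- a monochromatic path, so either it reaches n vertices, or it always has at most n/2
-- vertices on each side. No edge joins T to S, and as long as T covers less than
-- |X|/2 − n/4 of X and less than |Y|/2 − n/4 of Y, S keeps at least that much of both;
-- hence at the first moment T is that large on one side, T on that side and S on the other
-- give X′ ⊆ X, Y′ ⊆ Y with no edge of that colour between them and |X′| ≥ |X|/2 − n/4,
-- |Y′| ≥ |Y|/2 − n/4.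
-- Starting from X = V₁, Y = V₂ and repeating this for each of the r colours either finds a
-- monochromatic P_n or leaves two sets above the threshold of the hypothesis with no edge
-- at all between them, which is impossible.

open import Defs
open import Data.Nat using (ℕ; zero; suc; _+_; _*_; _^_; _≤_; _<_; z≤n; s≤s; _≤?_; _≟_)
open import Data.Nat.Properties
open import Data.Nat.Solver using (module +-*-Solver)
open import Data.Bool using (Bool; true; false; not; _∧_; _∨_; if_then_else_)
open import Data.Bool.Properties using (∧-identityʳ; ∧-zeroʳ)
import Data.Bool as Bool
open import Data.Fin using (Fin; zero; suc; toℕ; fromℕ<)
import Data.Fin as Fin
open import Data.Fin.Properties using (any?; toℕ<n; toℕ-injective; toℕ-fromℕ<)
import Data.Fin.Properties as Fin
open import Data.Fin.Subset using (Subset; ∣_∣)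
import Data.Fin.Subset as Subset
open import Data.Vec using (Vec; []; _∷_; tabulate; lookup)
open import Data.Vec.Properties using ([]=⇒lookup; lookup∘tabulate)
open import Data.Vec.Relation.Unary.All using (All; []; _∷_)
import Data.Vec.Relation.Unary.All as All
open import Data.Vec.Relation.Unary.Linked using (Linked; []; [-]; _∷_)
import Data.Vec.Relation.Unary.Linked as Linked
open import Data.Vec.Relation.Unary.Unique.Propositional using (Unique)
open import Data.Vec.Relation.Unary.Unique.Propositional.Properties using (lookup-injective)
open import Data.Vec.Relation.Unary.AllPairs using ([]; _∷_)
import Data.Vec.Relation.Unary.AllPairs as AllPairs
open import Data.Sum using (_⊎_; inj₁; inj₂)
open import Data.Sum.Properties using (≡-dec)
open import Data.Product using (_×_; _,_; ∃; ∃-syntax; Σ-syntax; proj₁; proj₂)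
open import Data.Empty using (⊥; ⊥-elim)
open import Function using (_∘_)
open import Relation.Nullary using (¬_; Dec; yes; no; does; contradiction)
open import Relation.Nullary.Decidable using (_×-dec_; dec-true; dec-false)
open import Relation.Binary using (Decidable)
open import Relation.Binary.PropositionalEquality
open import Algebra.Properties.CommutativeSemigroup +-commutativeSemigroup using (interchange; x∙yz≈y∙xz)

indicator : Bool → ℕ
indicator true  = 1
indicator false = 0

count : ∀ {m} → (Fin m → Bool) → ℕ
count {zero}  f = 0
count {suc m} f = indicator (f zero) + count (f ∘ suc)

count-cong : ∀ {m} {f g : Fin m → Bool} → (∀ x → f x ≡ g x) → count f ≡ count g
count-cong {zero}  f≗g = refl
count-cong {suc m} f≗g = cong₂ (λ b c → indicator b + c) (f≗g zero) (count-cong (f≗g ∘ suc))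

count-true : ∀ m → count {m} (λ _ → true) ≡ m
count-true zero    = refl
count-true (suc m) = cong suc (count-true m)

count-false : ∀ m → count {m} (λ _ → false) ≡ 0
count-false zero    = refl
count-false (suc m) = count-false m

count>0⇒∃ : ∀ {m} (f : Fin m → Bool) → 0 < count f → ∃[ x ] f x ≡ true
count>0⇒∃ {suc m} f 0<c with f zero in fzero
... | true  = zero , fzero
... | false = let x , fx = count>0⇒∃ (f ∘ suc) 0<c in suc x , fx

count-+ : ∀ {m} (f g h : Fin m → Bool) →
          (∀ x → indicator (f x) + indicator (g x) ≡ indicator (h x)) →
          count f + count g ≡ count h
count-+ {zero}  f g h f+g≗h = refl
count-+ {suc m} f g h f+g≗h = begin
  (a + c) + (b + d) ≡⟨ interchange a c b d ⟩
  (a + b) + (c + d) ≡⟨ cong₂ _+_ (f+g≗h zero) (count-+ (f ∘ suc) (g ∘ suc) (h ∘ suc) (f+g≗h ∘ suc)) ⟩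
  indicator (h zero) + count (h ∘ suc) ∎
  where
  open ≡-Reasoning
  a = indicator (f zero)
  b = indicator (g zero)
  c = count (f ∘ suc)
  d = count (g ∘ suc)

count-update : ∀ {m} (f f′ : Fin m → Bool) (x : Fin m) → (∀ y → y ≢ x → f′ y ≡ f y) →
               indicator (f x) + count f′ ≡ indicator (f′ x) + count f
count-update {suc m} f f′ zero f′≗f = trans
  (cong (λ c → indicator (f zero) + (indicator (f′ zero) + c)) (count-cong (λ y → f′≗f (suc y) λ ())))
  (x∙yz≈y∙xz (indicator (f zero)) (indicator (f′ zero)) (count (f ∘ suc)))
count-update {suc m} f f′ (suc x) f′≗f = begin
  a + (b′ + c′) ≡⟨ x∙yz≈y∙xz a b′ c′ ⟩
  b′ + (a + c′) ≡⟨ cong₂ _+_ (cong indicator (f′≗f zero λ ())) rest ⟩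
  b + (a′ + c)  ≡⟨ x∙yz≈y∙xz b a′ c ⟩
  a′ + (b + c)  ∎
  where
  open ≡-Reasoning
  a  = indicator (f (suc x))
  a′ = indicator (f′ (suc x))
  b  = indicator (f zero)
  b′ = indicator (f′ zero)
  c  = count (f ∘ suc)
  c′ = count (f′ ∘ suc)
  rest : a + c′ ≡ a′ + c
  rest = count-update (f ∘ suc) (f′ ∘ suc) x λ y y≢x → f′≗f (suc y) (y≢x ∘ Fin.suc-injective)

∣tabulate∣≡count : ∀ {m} (f : Fin m → Bool) → ∣ tabulate f ∣ ≡ count f
∣tabulate∣≡count {zero}  f = refl
∣tabulate∣≡count {suc m} f with f zero
... | true  = cong suc (∣tabulate∣≡count (f ∘ suc))
... | false = ∣tabulate∣≡count (f ∘ suc)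

2a≤4a+n : ∀ a n → 2 * a ≤ 4 * a + n
2a≤4a+n a n = ≤-trans (*-monoˡ-≤ a (m≤m+n 2 2)) (m≤m+n (4 * a) n)

remainder-large : ∀ s u t {a n} → s + u + t ≡ a → 2 * u ≤ n → 4 * t + n < 2 * a → 2 * a ≤ 4 * s + n
remainder-large s u t {a} {n} refl 2u≤n 4t+n<2a =
  <⇒≤ (+-cancelʳ-≤ (4 * t + n) (suc (2 * a)) (4 * s + n) (begin
    suc (2 * a) + (4 * t + n)         ≡⟨ +-comm (suc (2 * a)) (4 * t + n) ⟩
    (4 * t + n) + suc (2 * a)         ≡⟨ +-suc (4 * t + n) (2 * a) ⟩
    suc (4 * t + n) + 2 * a           ≤⟨ +-monoˡ-≤ (2 * a) 4t+n<2a ⟩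
    2 * a + 2 * a                     ≡⟨ solve 3 (λ s u t → con 2 :* (s :+ u :+ t) :+ con 2 :* (s :+ u :+ t)
                                                := con 4 :* s :+ con 2 :* (con 2 :* u) :+ con 4 :* t) refl s u t ⟩
    4 * s + 2 * (2 * u) + 4 * t       ≤⟨ +-monoˡ-≤ (4 * t) (+-monoʳ-≤ (4 * s) (*-monoʳ-≤ 2 2u≤n)) ⟩
    4 * s + 2 * n + 4 * t             ≡⟨ solve 3 (λ s t n → con 4 :* s :+ con 2 :* n :+ con 4 :* t
                                                := (con 4 :* s :+ n) :+ (con 4 :* t :+ n)) refl s t n ⟩
    (4 * s + n) + (4 * t + n)         ∎))
  where
  open ≤-Reasoning
  open +-*-Solver

measure-step : ∀ u ℓ → 2 * u + suc ℓ < 2 * suc u + ℓ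
measure-step u ℓ = ≤-reflexive
  (solve 2 (λ u ℓ → con 1 :+ (con 2 :* u :+ (con 1 :+ ℓ)) := con 2 :* (con 1 :+ u) :+ ℓ) refl u ℓ)
  where open +-*-Solver

threshold-step : ∀ k m n {a b} → AtLeastThreshold k m n a → 2 * a ≤ 4 * b + n → AtLeastThreshold (suc k) m n b
threshold-step k m n {a} {b} large 2a≤4b+n = ≤-trans large (begin
    2 * P * a + P * n          ≡⟨ cong (_+ P * n) (solve 2 (λ P a → con 2 :* P :* a := P :* (con 2 :* a)) refl P a) ⟩
    P * (2 * a) + P * n        ≤⟨ +-monoˡ-≤ (P * n) (*-monoʳ-≤ P 2a≤4b+n) ⟩
    P * (4 * b + n) + P * n    ≡⟨ solve 3 (λ P b n → P :* (con 4 :* b :+ n) :+ P :* n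
                                             := con 2 :* (con 2 :* P) :* b :+ con 2 :* P :* n) refl P b n ⟩
    2 * (2 * P) * b + 2 * P * n ∎)
  where
  open ≤-Reasoning
  open +-*-Solver
  P = 2 ^ k

-- Paths in a bipartite graph

linked-lookup : ∀ {A : Set} {R : A → A → Set} {ℓ} {xs : Vec A ℓ} → Linked R xs →
                ∀ i j → suc (toℕ i) ≡ toℕ j → R (lookup xs i) (lookup xs j)
linked-lookup {xs = _ ∷ _ ∷ _} (r ∷ _) zero    (suc zero) _  = r
linked-lookup {xs = _ ∷ _ ∷ _} (_ ∷ l) (suc i) (suc j)    eq = linked-lookup l i j (suc-injective eq)

module _ {m : ℕ} where

  Edge : (Fin m → Fin m → Set) → Vertex m → Vertex m → Set
  Edge R (inj₁ a) (inj₂ b) = R a b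
  Edge R (inj₂ b) (inj₁ a) = R a b
  Edge R (inj₁ _) (inj₁ _) = ⊥
  Edge R (inj₂ _) (inj₂ _) = ⊥

  Edge-sym : ∀ {R} u v → Edge R u v → Edge R v u
  Edge-sym (inj₁ _) (inj₂ _) e = e
  Edge-sym (inj₂ _) (inj₁ _) e = e

  Edge? : ∀ {R} → Decidable R → Decidable (Edge R)
  Edge? R? (inj₁ a) (inj₂ b) = R? a b
  Edge? R? (inj₂ b) (inj₁ a) = R? a b
  Edge? R? (inj₁ _) (inj₁ _) = no λ ()
  Edge? R? (inj₂ _) (inj₂ _) = no λ ()

  anyVertex? : {P : Vertex m → Set} → (∀ v → Dec (P v)) → Dec (∃ P)
  anyVertex? P? with any? (P? ∘ inj₁) | any? (P? ∘ inj₂)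
  ... | yes (x , p) | _           = yes (inj₁ x , p)
  ... | no _        | yes (y , p) = yes (inj₂ y , p)
  ... | no ¬p₁      | no ¬p₂      = no λ { (inj₁ x , p) → ¬p₁ (x , p) ; (inj₂ y , p) → ¬p₂ (y , p) }

  Path : (Fin m → Fin m → Set) → ℕ → Set
  Path R n = Σ[ p ∈ Vec (Vertex m) n ] Unique p × Linked (Edge R) p

  -- Sides are indexed by Bool: true is V₁ (inj₁), false is V₂ (inj₂).
  inSide : Bool → Vertex m → Bool
  inSide i (inj₁ _) = i
  inSide i (inj₂ _) = not i

  onSide : ∀ {ℓ} → Bool → Vec (Vertex m) ℓ → ℕ
  onSide i []       = 0
  onSide i (v ∷ vs) = indicator (inSide i v) + onSide i vs

  onSide-sum : ∀ i {ℓ} (vs : Vec (Vertex m) ℓ) → onSide i vs + onSide (not i) vs ≡ ℓ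
  onSide-sum i     []            = refl
  onSide-sum true  (inj₁ _ ∷ vs) = cong suc (onSide-sum true vs)
  onSide-sum false (inj₂ _ ∷ vs) = cong suc (onSide-sum false vs)
  onSide-sum true  (inj₂ _ ∷ vs) = trans (+-suc (onSide true vs) _) (cong suc (onSide-sum true vs))
  onSide-sum false (inj₁ _ ∷ vs) = trans (+-suc (onSide false vs) _) (cong suc (onSide-sum false vs))

  sides-add-one : ∀ (v : Vertex m) {a b c d} → indicator (inSide true v) + a ≡ c → indicator (inSide false v) + b ≡ d →
                  suc (a + b) ≡ c + d
  sides-add-one (inj₁ _)         a≡c b≡d = cong₂ _+_ a≡c b≡d
  sides-add-one (inj₂ _) {a} {b} a≡c b≡d = trans (sym (+-suc a b)) (cong₂ _+_ a≡c b≡d)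

  side : Vertex m → Bool
  side (inj₁ _) = true
  side (inj₂ _) = false

  path-alternates : ∀ {R ℓ} v {vs : Vec (Vertex m) ℓ} → Linked (Edge R) (v ∷ vs) →
    let a = onSide (side v) (v ∷ vs) ; b = onSide (not (side v)) (v ∷ vs) in b ≤ a × a ≤ suc b
  path-alternates (inj₁ a) {[]}          [-]     = z≤n , s≤s z≤n
  path-alternates (inj₁ a) {inj₂ b ∷ vs} (_ ∷ p) =
    let b≤a , a≤1+b = path-alternates (inj₂ b) p in a≤1+b , s≤s b≤a
  path-alternates (inj₂ b) {[]}          [-]     = z≤n , s≤s z≤n
  path-alternates (inj₂ b) {inj₁ a ∷ vs} (_ ∷ p) =
    let b≤a , a≤1+b = path-alternates (inj₁ a) p in a≤1+b , s≤s b≤a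

  path-sides-close : ∀ {R ℓ} {vs : Vec (Vertex m) ℓ} → Linked (Edge R) vs →
                     ∀ i → onSide i vs ≤ suc (onSide (not i) vs)
  path-sides-close {vs = []}         []  i     = z≤n
  path-sides-close {vs = inj₁ a ∷ vs} p true  = proj₂ (path-alternates (inj₁ a) p)
  path-sides-close {vs = inj₂ b ∷ vs} p false = proj₂ (path-alternates (inj₂ b) p)
  path-sides-close {vs = inj₁ a ∷ vs} p false = m≤n⇒m≤1+n (proj₁ (path-alternates (inj₁ a) p))
  path-sides-close {vs = inj₂ b ∷ vs} p true  = m≤n⇒m≤1+n (proj₁ (path-alternates (inj₂ b) p))

  path-balanced : ∀ {R ℓ} {vs : Vec (Vertex m) ℓ} → Linked (Edge R) vs → ∀ i → 2 * onSide i vs ≤ suc ℓ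
  path-balanced {ℓ = ℓ} {vs} p i = begin
    a + (a + 0) ≡⟨ cong (a +_) (+-identityʳ a) ⟩
    a + a       ≤⟨ +-monoʳ-≤ a (path-sides-close p i) ⟩
    a + suc b   ≡⟨ +-suc a b ⟩
    suc (a + b) ≡⟨ cong suc (onSide-sum i vs) ⟩
    suc ℓ       ∎
    where
    open ≤-Reasoning
    a = onSide i vs
    b = onSide (not i) vs

record IndependentPair {m} (R : Fin m → Fin m → Set) (n : ℕ) (X Y : Fin m → Bool) : Set where
  field
    X′ Y′       : Fin m → Bool
    X′⊆X        : ∀ {x} → X′ x ≡ true → X x ≡ true
    Y′⊆Y        : ∀ {y} → Y′ y ≡ true → Y y ≡ true
    X′-large    : 2 * count X ≤ 4 * count X′ + n
    Y′-large    : 2 * count Y ≤ 4 * count Y′ + n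
    independent : ∀ {x y} → X′ x ≡ true → Y′ y ≡ true → ¬ R x y

-- Depth-first search

-- The sets S, U, T of the search; inactive marks the vertices outside X ∪ Y.
data Status : Set where
  unvisited stacked finished inactive : Status

isUnvisited isStacked isFinished isActive : Status → Bool
isUnvisited unvisited = true
isUnvisited _         = false
isStacked stacked = true
isStacked _       = false
isFinished finished = true
isFinished _        = false
isActive inactive = false
isActive _        = true

isUnvisited-sound : ∀ s → isUnvisited s ≡ true → s ≡ unvisited
isUnvisited-sound unvisited _ = refl

isFinished-sound : ∀ s → isFinished s ≡ true → s ≡ finished
isFinished-sound finished _ = refl

module _ {m : ℕ} where

  vertexOn : Bool → Fin m → Vertex m
  vertexOn true  = inj₁
  vertexOn false = inj₂

  _≟ᵥ_ : (u v : Vertex m) → Dec (u ≡ v)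
  _≟ᵥ_ = ≡-dec Fin._≟_ Fin._≟_

  _[_]≔_ : (Vertex m → Status) → Vertex m → Status → Vertex m → Status
  (st [ v ]≔ τ) w = if does (w ≟ᵥ v) then τ else st w

  []≔-same : ∀ st v τ → (st [ v ]≔ τ) v ≡ τ
  []≔-same st v τ rewrite dec-true (v ≟ᵥ v) refl = refl

  []≔-other : ∀ st {v} τ {w} → w ≢ v → (st [ v ]≔ τ) w ≡ st w
  []≔-other st {v} τ {w} w≢v rewrite dec-false (w ≟ᵥ v) w≢v = refl

  []≔-other-all : ∀ st {v} τ {σ ℓ} {us : Vec (Vertex m) ℓ} →
                  All (λ u → st u ≡ σ) us → All (v ≢_) us → All (λ u → (st [ v ]≔ τ) u ≡ σ) us
  []≔-other-all st τ stus v∉us =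
    All.map (λ (stu , v≢u) → trans ([]≔-other st τ (v≢u ∘ sym)) stu) (All.zip (stus , v∉us))

  []≔-reflects : ∀ st v τ w {σ} → (st [ v ]≔ τ) w ≡ σ → σ ≢ τ → st w ≡ σ
  []≔-reflects st v τ w eq σ≢τ with w ≟ᵥ v
  ... | yes _ = contradiction (sym eq) σ≢τ
  ... | no  _ = eq

  []≔-preserves : ∀ (P : Status → Bool) st {v τ} → P τ ≡ P (st v) → ∀ w → P ((st [ v ]≔ τ) w) ≡ P (st w)
  []≔-preserves P st {v} Pτ≡Pσ w with w ≟ᵥ v
  ... | yes refl = Pτ≡Pσ
  ... | no  _    = refl

  countOn : (Status → Bool) → (Vertex m → Status) → Bool → ℕ
  countOn P st i = count (λ x → P (st (vertexOn i x)))

  vertexOn-injective : ∀ i {x y} → vertexOn i x ≡ vertexOn i y → x ≡ y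
  vertexOn-injective true  refl = refl
  vertexOn-injective false refl = refl

  countOn-update-here : ∀ P st τ i x →
    indicator (P (st (vertexOn i x))) + countOn P (st [ vertexOn i x ]≔ τ) i ≡ indicator (P τ) + countOn P st i
  countOn-update-here P st τ i x = trans
    (count-update (λ y → P (st (vertexOn i y))) (λ y → P ((st [ vertexOn i x ]≔ τ) (vertexOn i y))) x
                  (λ y y≢x → cong P ([]≔-other st τ (y≢x ∘ vertexOn-injective i))))
    (cong (λ s → indicator (P s) + countOn P st i) ([]≔-same st (vertexOn i x) τ))

  countOn-update-elsewhere : ∀ P st τ i x →
    countOn P (st [ vertexOn (not i) x ]≔ τ) i ≡ countOn P st i
  countOn-update-elsewhere P st τ true  x = count-cong λ y → cong P ([]≔-other st {inj₂ x} τ {inj₁ y} λ ())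
  countOn-update-elsewhere P st τ false x = count-cong λ y → cong P ([]≔-other st {inj₁ x} τ {inj₂ y} λ ())

  -- P σ and P τ come first in the conjunctions so that both sides compute once σ and τ are known.
  countOn-update : ∀ P st {v σ} τ i → st v ≡ σ →
    indicator (P σ ∧ inSide i v) + countOn P (st [ v ]≔ τ) i ≡ indicator (P τ ∧ inSide i v) + countOn P st i
  countOn-update P st {inj₁ x} τ true refl
    rewrite ∧-identityʳ (P (st (inj₁ x))) | ∧-identityʳ (P τ) = countOn-update-here P st τ true x
  countOn-update P st {inj₂ y} τ false refl
    rewrite ∧-identityʳ (P (st (inj₂ y))) | ∧-identityʳ (P τ) = countOn-update-here P st τ false y
  countOn-update P st {inj₁ x} τ false refl
    rewrite ∧-zeroʳ (P (st (inj₁ x))) | ∧-zeroʳ (P τ) = countOn-update-elsewhere P st τ false x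
  countOn-update P st {inj₂ y} τ true refl
    rewrite ∧-zeroʳ (P (st (inj₂ y))) | ∧-zeroʳ (P τ) = countOn-update-elsewhere P st τ true y

module DepthFirstSearch {m : ℕ} {R : Fin m → Fin m → Set} (R? : Decidable R)
                        {n : ℕ} (0<n : 0 < n) (X Y : Fin m → Bool) where

  active : Vertex m → Bool
  active (inj₁ x) = X x
  active (inj₂ y) = Y y

  activeOn : Bool → ℕ
  activeOn i = count (λ x → active (vertexOn i x))

  record Invariant (st : Vertex m → Status) {ℓ} (stack : Vec (Vertex m) ℓ) : Set where
    field
      activity-fixed    : ∀ v → isActive (st v) ≡ active v
      stack-stacked     : All (λ v → st v ≡ stacked) stack
      stack-unique      : Unique stack
      stack-path        : Linked (Edge R) stack
      stack-short       : ℓ < n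
      stacked-count     : ∀ i → countOn isStacked st i ≡ onSide i stack
      finished-isolated : ∀ {v w} → st v ≡ finished → st w ≡ unvisited → ¬ Edge R v w
      unvisited-large   : ∀ i → 2 * activeOn i ≤ 4 * countOn isUnvisited st i + n

  open Invariant

  record State : Set where
    constructor state
    field
      status    : Vertex m → Status
      {depth}   : ℕ
      stack     : Vec (Vertex m) depth
      invariant : Invariant status stack

  unvisitedTotal : (Vertex m → Status) → ℕ
  unvisitedTotal st = countOn isUnvisited st true + countOn isUnvisited st false

  measure : State → ℕ
  measure (state st {ℓ} _ _) = 2 * unvisitedTotal st + ℓ

  Done : (Vertex m → Status) → Bool → Set
  Done st i = 2 * activeOn i ≤ 4 * countOn isFinished st i + n

  Done? : ∀ st i → Dec (Done st i)
  Done? st i = 2 * activeOn i ≤? 4 * countOn isFinished st i + n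

  statuses-partition : ∀ {st} → (∀ v → isActive (st v) ≡ active v) → ∀ i →
    countOn isUnvisited st i + countOn isStacked st i + countOn isFinished st i ≡ activeOn i
  statuses-partition {st} activity i = begin
    U + S + F                         ≡⟨ cong (_+ F) (count-+ _ _ _ (unvisited-or-stacked ∘ status)) ⟩
    count (isOpen ∘ status) + F       ≡⟨ count-+ _ _ _ (open-or-finished ∘ status) ⟩
    count (isActive ∘ status)         ≡⟨ count-cong (activity ∘ vertexOn i) ⟩
    activeOn i                        ∎
    where
    open ≡-Reasoning
    status = st ∘ vertexOn i
    U = countOn isUnvisited st i
    S = countOn isStacked st i
    F = countOn isFinished st i
    isOpen : Status → Bool
    isOpen s = isUnvisited s ∨ isStacked s
    unvisited-or-stacked : ∀ s → indicator (isUnvisited s) + indicator (isStacked s) ≡ indicator (isOpen s)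
    unvisited-or-stacked unvisited = refl
    unvisited-or-stacked stacked   = refl
    unvisited-or-stacked finished  = refl
    unvisited-or-stacked inactive  = refl
    open-or-finished : ∀ s → indicator (isOpen s) + indicator (isFinished s) ≡ indicator (isActive s)
    open-or-finished unvisited = refl
    open-or-finished stacked   = refl
    open-or-finished finished  = refl
    open-or-finished inactive  = refl

  activity-after-update : ∀ {st v σ τ} → (∀ u → isActive (st u) ≡ active u) → st v ≡ σ → isActive τ ≡ isActive σ →
                          ∀ u → isActive ((st [ v ]≔ τ) u) ≡ active u
  activity-after-update {st} activity stv τ~σ u =
    trans ([]≔-preserves isActive st (trans τ~σ (cong isActive (sym stv))) u) (activity u)

  module _ {st : Vertex m → Status} {ℓ} {stack : Vec (Vertex m) ℓ} (I : Invariant st stack) where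

    fresh : ∀ {w} → st w ≡ unvisited → All (w ≢_) stack
    fresh stw = All.map (λ stu w≡u → unvisited≢stacked (trans (sym stw) (trans (cong st w≡u) stu))) (stack-stacked I)
      where
      unvisited≢stacked : unvisited ≢ stacked
      unvisited≢stacked ()

    push-invariant : ∀ {w} → st w ≡ unvisited → Linked (Edge R) (w ∷ stack) → suc ℓ < n →
                     (∀ i → ¬ Done st i) → Invariant (st [ w ]≔ stacked) (w ∷ stack)
    push-invariant {w} stw path 1+ℓ<n ¬done = record
      { activity-fixed    = activity-fixed′
      ; stack-stacked     = []≔-same st w stacked ∷ []≔-other-all st stacked (stack-stacked I) (fresh stw)
      ; stack-unique      = fresh stw ∷ stack-unique I
      ; stack-path        = path
      ; stack-short       = 1+ℓ<n
      ; stacked-count     = stacked-count′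
      ; finished-isolated = λ {a} {b} sa sb →
          finished-isolated I ([]≔-reflects st w stacked a sa λ ()) ([]≔-reflects st w stacked b sb λ ())
      ; unvisited-large   = unvisited-large′
      }
      where
      st′ = st [ w ]≔ stacked
      activity-fixed′ : ∀ v → isActive (st′ v) ≡ active v
      activity-fixed′ = activity-after-update (activity-fixed I) stw refl
      stacked-count′ : ∀ i → countOn isStacked st′ i ≡ onSide i (w ∷ stack)
      stacked-count′ i =
        trans (countOn-update isStacked st stacked i stw) (cong (indicator (inSide i w) +_) (stacked-count I i))
      unvisited-large′ : ∀ i → 2 * activeOn i ≤ 4 * countOn isUnvisited st′ i + n
      unvisited-large′ i = remainder-large (countOn isUnvisited st′ i) (countOn isStacked st′ i) (countOn isFinished st′ i)
        (statuses-partition activity-fixed′ i) stack-small finished-small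
        where
        stack-small : 2 * countOn isStacked st′ i ≤ n
        stack-small = subst (λ u → 2 * u ≤ n) (sym (stacked-count′ i)) (≤-trans (path-balanced path i) 1+ℓ<n)
        finished-small : 4 * countOn isFinished st′ i + n < 2 * activeOn i
        finished-small = subst (λ t → 4 * t + n < 2 * activeOn i) (sym (countOn-update isFinished st stacked i stw))
                               (≰⇒> (¬done i))

    push-measure : ∀ {w} (stw : st w ≡ unvisited) path 1+ℓ<n ¬done →
      measure (state _ _ (push-invariant stw path 1+ℓ<n ¬done)) < measure (state st stack I)
    push-measure {w} stw _ _ _ = subst (λ u → 2 * unvisitedTotal st′ + suc ℓ < 2 * u + ℓ)
      (sides-add-one w (drop true) (drop false)) (measure-step (unvisitedTotal st′) ℓ)
      where
      st′ = st [ w ]≔ stacked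
      drop : ∀ i → indicator (inSide i w) + countOn isUnvisited st′ i ≡ countOn isUnvisited st i
      drop i = countOn-update isUnvisited st stacked i stw

  module _ {st : Vertex m → Status} {ℓ} {v} {stack : Vec (Vertex m) ℓ} (I : Invariant st (v ∷ stack)) where

    top-stacked : st v ≡ stacked
    top-stacked = All.head (stack-stacked I)

    pop-invariant : (∀ {w} → st w ≡ unvisited → ¬ Edge R v w) → Invariant (st [ v ]≔ finished) stack
    pop-invariant saturated = record
      { activity-fixed    = activity-after-update (activity-fixed I) top-stacked refl
      ; stack-stacked     = []≔-other-all st finished (All.tail (stack-stacked I)) (AllPairs.head (stack-unique I))
      ; stack-unique      = AllPairs.tail (stack-unique I)
      ; stack-path        = Linked.tail (stack-path I)
      ; stack-short       = <-trans (n<1+n ℓ) (stack-short I)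
      ; stacked-count     = λ i → +-cancelˡ-≡ (indicator (inSide i v)) _ _
                              (trans (countOn-update isStacked st finished i top-stacked) (stacked-count I i))
      ; finished-isolated = finished-isolated′
      ; unvisited-large   = λ i → subst (λ u → 2 * activeOn i ≤ 4 * u + n)
                              (sym (countOn-update isUnvisited st finished i top-stacked)) (unvisited-large I i)
      }
      where
      finished-isolated′ : ∀ {a b} → (st [ v ]≔ finished) a ≡ finished →
                           (st [ v ]≔ finished) b ≡ unvisited → ¬ Edge R a b
      finished-isolated′ {a} {b} sa sb with a ≟ᵥ v
      ... | yes refl = saturated ([]≔-reflects st v finished b sb λ ())
      ... | no  a≢v  = finished-isolated I sa ([]≔-reflects st v finished b sb λ ())

    pop-measure : ∀ (saturated : ∀ {w} → st w ≡ unvisited → ¬ Edge R v w) →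
      measure (state _ _ (pop-invariant saturated)) < measure (state st (v ∷ stack) I)
    pop-measure _ = subst (λ u → 2 * u + ℓ < 2 * unvisitedTotal st + suc ℓ) (sym unchanged)
      (+-monoʳ-< (2 * unvisitedTotal st) (n<1+n ℓ))
      where
      unchanged : unvisitedTotal (st [ v ]≔ finished) ≡ unvisitedTotal st
      unchanged = cong₂ _+_ (countOn-update isUnvisited st finished true top-stacked)
                            (countOn-update isUnvisited st finished false top-stacked)

  module _ {st : Vertex m → Status} {ℓ} {stack : Vec (Vertex m) ℓ} (I : Invariant st stack) where

    active-if : ∀ {v σ} → st v ≡ σ → active v ≡ isActive σ
    active-if {v} stv = trans (sym (activity-fixed I v)) (cong isActive stv)

    split-on-V₁ : Done st true → IndependentPair R n X Y
    split-on-V₁ done = record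
      { X′          = λ x → isFinished (st (inj₁ x))
      ; Y′          = λ y → isUnvisited (st (inj₂ y))
      ; X′⊆X        = λ fx → active-if (isFinished-sound _ fx)
      ; Y′⊆Y        = λ uy → active-if (isUnvisited-sound _ uy)
      ; X′-large    = done
      ; Y′-large    = unvisited-large I false
      ; independent = λ fx uy → finished-isolated I (isFinished-sound _ fx) (isUnvisited-sound _ uy)
      }

    split-on-V₂ : Done st false → IndependentPair R n X Y
    split-on-V₂ done = record
      { X′          = λ x → isUnvisited (st (inj₁ x))
      ; Y′          = λ y → isFinished (st (inj₂ y))
      ; X′⊆X        = λ ux → active-if (isUnvisited-sound _ ux)
      ; Y′⊆Y        = λ fy → active-if (isFinished-sound _ fy)
      ; X′-large    = unvisited-large I true
      ; Y′-large    = done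
      ; independent = λ ux fy → finished-isolated I (isFinished-sound _ fy) (isUnvisited-sound _ ux)
      }

  unvisited-exists : ∀ {st} → Invariant st [] → ¬ Done st true → ∃[ x ] isUnvisited (st (inj₁ x)) ≡ true
  unvisited-exists {st} I ¬done =
    count>0⇒∃ _ (n≢0⇒n>0 λ none →
      ¬done (subst (λ t → 2 * activeOn true ≤ 4 * t + n) (all-finished none) (2a≤4a+n (activeOn true) n)))
    where
    all-finished : countOn isUnvisited st true ≡ 0 → activeOn true ≡ countOn isFinished st true
    all-finished none = trans (sym (statuses-partition (activity-fixed I) true))
                              (cong₂ (λ u s → u + s + countOn isFinished st true) none (stacked-count I true))

  unvisited-neighbour? : ∀ (st : Vertex m → Status) v → Dec (∃[ w ] isUnvisited (st w) ≡ true × Edge R v w)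
  unvisited-neighbour? st v = anyVertex? (λ w → (isUnvisited (st w) Bool.≟ true) ×-dec Edge? R? v w)

  advance : ∀ {st ℓ} {stack : Vec (Vertex m) ℓ} {w} (I : Invariant st stack) → st w ≡ unvisited →
            Linked (Edge R) (w ∷ stack) → (∀ i → ¬ Done st i) →
            Path R n ⊎ Σ[ s ∈ State ] measure s < measure (state st stack I)
  advance {ℓ = ℓ} {stack} {w} I stw path ¬done with suc ℓ ≟ n
  ... | yes refl  = inj₁ (w ∷ stack , fresh I stw ∷ stack-unique I , path)
  ... | no 1+ℓ≢n  = let 1+ℓ<n = ≤∧≢⇒< (stack-short I) 1+ℓ≢n in
    inj₂ (state _ _ (push-invariant I stw path 1+ℓ<n ¬done) , push-measure I stw path 1+ℓ<n ¬done)

  step : (s : State) → (∀ i → ¬ Done (State.status s) i) → Path R n ⊎ Σ[ s′ ∈ State ] measure s′ < measure s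
  step (state st [] I) ¬done =
    let x , ux = unvisited-exists I (¬done true) in advance I (isUnvisited-sound _ ux) [-] ¬done
  step (state st (v ∷ stack) I) ¬done with unvisited-neighbour? st v
  ... | yes (w , uw , e) = advance I (isUnvisited-sound _ uw) (Edge-sym v w e ∷ stack-path I) ¬done
  ... | no none          = inj₂ (state _ _ (pop-invariant I saturated) , pop-measure I saturated)
    where
    saturated : ∀ {w} → st w ≡ unvisited → ¬ Edge R v w
    saturated {w} stw e = none (w , cong isUnvisited stw , e)

  run : ∀ fuel (s : State) → measure s < fuel → Path R n ⊎ IndependentPair R n X Y
  run zero       _                  ()
  run (suc fuel) s@(state st _ I) s<fuel with Done? st true | Done? st false
  ... | yes done | _        = inj₂ (split-on-V₁ I done)
  ... | no _     | yes done = inj₂ (split-on-V₂ I done)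
  ... | no ¬d₁   | no ¬d₂   with step s (λ { true → ¬d₁ ; false → ¬d₂ })
  ...   | inj₁ path        = inj₁ path
  ...   | inj₂ (s′ , s′<s) = run fuel s′ (≤-trans s′<s (≤-pred s<fuel))

  startStatus : Bool → Status
  startStatus true  = unvisited
  startStatus false = inactive

  initial : Invariant (startStatus ∘ active) []
  initial = record
    { activity-fixed    = λ v → isActive-start (active v)
    ; stack-stacked     = []
    ; stack-unique      = []
    ; stack-path        = []
    ; stack-short       = 0<n
    ; stacked-count     = λ i → trans (count-cong (λ x → isStacked-start (active (vertexOn i x)))) (count-false m)
    ; finished-isolated = λ {v} fv → ⊥-elim (not-finished (active v) fv)
    ; unvisited-large   = λ i → subst (λ u → 2 * activeOn i ≤ 4 * u + n)
                            (count-cong (λ x → sym (isUnvisited-start (active (vertexOn i x))))) (2a≤4a+n (activeOn i) n)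
    }
    where
    isActive-start : ∀ b → isActive (startStatus b) ≡ b
    isActive-start true  = refl
    isActive-start false = refl
    isStacked-start : ∀ b → isStacked (startStatus b) ≡ false
    isStacked-start true  = refl
    isStacked-start false = refl
    isUnvisited-start : ∀ b → isUnvisited (startStatus b) ≡ b
    isUnvisited-start true  = refl
    isUnvisited-start false = refl
    not-finished : ∀ b → startStatus b ≢ finished
    not-finished true  ()
    not-finished false ()

  path-or-independent-pair : Path R n ⊎ IndependentPair R n X Y
  path-or-independent-pair = run (suc (measure s₀)) s₀ ≤-refl
    where s₀ = state (startStatus ∘ active) [] initial

open DepthFirstSearch using (path-or-independent-pair)

-- Colour classes

module _ {m r : ℕ} (E : BipGraph m) (χ : EdgeColouring m r) where

  ColourClass : Fin r → Fin m → Fin m → Set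
  ColourClass k a b = E a b ≡ true × χ a b ≡ k

  ColourClass? : ∀ k → Decidable (ColourClass k)
  ColourClass? k a b = (E a b Bool.≟ true) ×-dec (χ a b Fin.≟ k)

  Edge⇒EdgeOfColour : ∀ {k} u v → Edge (ColourClass k) u v → EdgeOfColour E χ k u v
  Edge⇒EdgeOfColour (inj₁ _) (inj₂ _) e = e
  Edge⇒EdgeOfColour (inj₂ _) (inj₁ _) e = e

  Path⇒MonoPath : ∀ {k n} → Path (ColourClass k) n → MonoPath E χ k n
  Path⇒MonoPath (p , unique , linked) =
    lookup p , lookup-injective unique _ _ , λ i j 1+i≡j → Edge⇒EdgeOfColour _ _ (linked-lookup linked i j 1+i≡j)

  record HighColourPair (n k : ℕ) : Set where
    field
      X Y      : Fin m → Bool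
      colour-≥ : ∀ {x y} → X x ≡ true → Y y ≡ true → E x y ≡ true → k ≤ toℕ (χ x y)
      X-large  : AtLeastThreshold k m n (count X)
      Y-large  : AtLeastThreshold k m n (count Y)

  next-colour : ∀ {n k} → 0 < n → k < r → HighColourPair n k → (∃[ c ] MonoPath E χ c n) ⊎ HighColourPair n (suc k)
  next-colour {n} {k} 0<n k<r pair with path-or-independent-pair (ColourClass? (fromℕ< k<r)) 0<n X Y
    where open HighColourPair pair
  ... | inj₁ path  = inj₁ (fromℕ< k<r , Path⇒MonoPath path)
  ... | inj₂ split = inj₂ record
    { X        = X′
    ; Y        = Y′
    ; colour-≥ = λ x′ y′ e → ≤∧≢⇒< (colour-≥ (X′⊆X x′) (Y′⊆Y y′) e)
                   (λ k≡χ → independent x′ y′ (e , toℕ-injective (trans (sym k≡χ) (sym (toℕ-fromℕ< k<r)))))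
    ; X-large  = threshold-step k m n X-large X′-large
    ; Y-large  = threshold-step k m n Y-large Y′-large
    }
    where
    open HighColourPair pair
    open IndependentPair split

  high-colour-pair : ∀ {n} → 0 < n → ∀ k → k ≤ r → (∃[ c ] MonoPath E χ c n) ⊎ HighColourPair n k
  high-colour-pair {n} 0<n zero _ = inj₂ record
    { X        = λ _ → true
    ; Y        = λ _ → true
    ; colour-≥ = λ _ _ _ → z≤n
    ; X-large  = everything-large
    ; Y-large  = everything-large
    }
    where
    everything-large : AtLeastThreshold 0 m n (count {m} (λ _ → true))
    everything-large rewrite count-true m =
      ≤-reflexive (solve 2 (λ m n → m :+ m :+ n := con 2 :* m :+ con 1 :* n) refl m n)
      where open +-*-Solver
  high-colour-pair 0<n (suc k) k<r with high-colour-pair 0<n k (<⇒≤ k<r)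
  ... | inj₁ path = inj₁ path
  ... | inj₂ pair = next-colour 0<n k<r pair

  top-colour-pair-independent : ∀ {n} (pair : HighColourPair n r) → let open HighColourPair pair in
    ∀ {x y} → X x ≡ true → Y y ≡ true → E x y ≢ true
  top-colour-pair-independent pair x y e = <⇒≱ (toℕ<n (χ _ _)) (HighColourPair.colour-≥ pair x y e)

∈-tabulate : ∀ {m} {f : Fin m → Bool} {x} → x Subset.∈ tabulate f → f x ≡ true
∈-tabulate {f = f} {x} x∈ = trans (sym (lookup∘tabulate f x)) ([]=⇒lookup x∈)

lemma3p7 : (r n m : ℕ) → 2 ≤ r → 1 ≤ n →
    2 ^ r * n < m + m + n →
    (E : BipGraph m) →
    (∀ (S T : Subset m) → AtLeastThreshold r m n ∣ S ∣ → AtLeastThreshold r m n ∣ T ∣ →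
      EdgeBetween E S T) →
    Arrows E n r
lemma3p7 r n m _ 0<n _ E edge-between χ with high-colour-pair E χ 0<n r ≤-refl
... | inj₁ path = path
... | inj₂ pair =
  let a , b , a∈X , b∈Y , e = edge-between (tabulate X) (tabulate Y) (tabulated X X-large) (tabulated Y Y-large)
  in ⊥-elim (top-colour-pair-independent E χ pair (∈-tabulate a∈X) (∈-tabulate b∈Y) e)
  where
  open HighColourPair pair
  tabulated : ∀ Z → AtLeastThreshold r m n (count Z) → AtLeastThreshold r m n ∣ tabulate Z ∣
  tabulated Z = subst (AtLeastThreshold r m n) (sym (∣tabulate∣≡count Z))
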